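{- For every positive integer $n$, $$t(1,3,9;n)=t(1,3,27;3n+1)=\frac 12N(1,3,9;8n+13).$$
   Context: For positive integers $a_1,\dots,a_k$ and a nonnegative integer $n$, $N(a_1,\dots,a_k;n)$ is the number of $(x_1,\dots,x_k)\in\mathbb Z^k$ with $n=a_1x_1^2+\cdots+a_kx_k^2$, and $t(a_1,\dots,a_k;n)$ is the number of $(x_1,\dots,x_k)\in\mathbb Z^k$ with $n=a_1\frac{x_1(x_1-1)}2+\cdots+a_k\frac{x_k(x_k-1)}2$. -}

module Defs where

open import Data.Nat using (ℕ; suc)
open import Data.Integer using (ℤ; +_; -[1+_]; _+_; _*_; _-_)
open import Data.List using (List; []; _∷_; _++_; map; length; filter; concatMap; reverse)
open import Data.Product using (_×_; _,_)
open import Relation.Binary.PropositionalEquality using (_≡_)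
open import Data.Integer.Properties using (_≟_)

range : ℕ → List ℤ
range B = map -[1+_] (downFrom B) ++ map +_ (0 ∷ map suc (downFrom B))
  where
  downFrom : ℕ → List ℕ
  downFrom 0 = []
  downFrom (suc m) = m ∷ downFrom m

box3 : ℕ → List (ℤ × ℤ × ℤ)
box3 B = concatMap (λ x → concatMap (λ y → map (λ z → (x , y , z)) (range B)) (range B)) (range B)

Q : ℕ → ℕ → ℕ → ℤ × ℤ × ℤ → ℤ
Q a b c (x , y , z) = + a * (x * x) + + b * (y * y) + + c * (z * z)

T2 : ℕ → ℕ → ℕ → ℤ × ℤ × ℤ → ℤ
T2 a b c (x , y , z) = + a * (x * (x - + 1)) + + b * (y * (y - + 1)) + + c * (z * (z - + 1))

-- N(a,b,c;n) : number of (x,y,z) ∈ ℤ^3 with n = a x^2 + b y^2 + c z^2.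
-- For a,b,c ≥ 1 every solution satisfies |x|,|y|,|z| ≤ n (since x^2 ≥ |x|),
-- so counting inside the box [-n,n]^3 counts all solutions.
N3 : ℕ → ℕ → ℕ → ℕ → ℕ
N3 a b c n = length (filter (λ v → Q a b c v ≟ + n) (box3 n))

-- t(a,b,c;n) : number of (x,y,z) ∈ ℤ^3 with n = a x(x-1)/2 + b y(y-1)/2 + c z(z-1)/2,
-- i.e. 2n = a x(x-1) + b y(y-1) + c z(z-1).
-- For a,b,c ≥ 1 every solution has |x|,|y|,|z| ≤ n+1 (since x(x-1)/2 ≥ |x|-1),
-- so counting inside the box [-(n+1),n+1]^3 counts all solutions.
t3 : ℕ → ℕ → ℕ → ℕ → ℕ
t3 a b c n = length (filter (λ v → T2 a b c v ≟ + (2 Data.Nat.* n)) (box3 (suc n)))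

{-# OPTIONS --safe #-}
-- Substituting (x, y, z) ↦ (3y − 1, x, z) turns x(x−1) + 3y(y−1) + 9z(z−1) = 2n into
-- x(x−1) + 3y(y−1) + 27z(z−1) = 2(3n + 1), and every solution of the latter has x ≡ 2 (mod 3).
--
-- For the second identity, v ↦ 2v − 1 identifies the solutions counted by t(1,3,9;n) with the all-odd
-- solutions of x² + 3y² + 9z² = 8n + 13.  Modulo 8, a solution that is not all odd has (y, z) if z is
-- even, and (x, y) otherwise, even and incongruent modulo 4.  The involution ρ(b + 2k, b) = (k + 2b, k)
-- preserves a² + 3b² and exchanges such pairs with odd pairs congruent modulo 4, so there are as many
-- solutions that are not all odd as all-odd solutions with y ≡ z plus all-odd solutions with x ≡ y (mod 4).
-- Negating z, resp. y, shows that each of these is half of the all-odd solutions, since for odd a, b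
-- exactly one of a ≡ b and a ≡ −b (mod 4) holds.
module Submission where

open import Defs

module Representations where

  open import Data.Integer using (ℤ; +_; -[1+_]; _+_; _*_; _-_; -_; ∣_∣; _⊖_; _%ℕ_; _/ℕ_; 0ℤ; 1ℤ)
  open import Data.Integer.DivMod using (a≡a%ℕn+[a/ℕn]*n; n%ℕd<d)
  open import Data.Integer.Divisibility.Signed using (divides; ∣⇒∣ᵤ)
  open import Data.Integer.Properties
    using (_≟_; +-injective; pos-+; pos-*; ∣i∣≡0⇒i≡0; i-j≡0⇒i≡j; m-n≡m⊖n; ∣m⊝n∣≤m⊔n; *-cancelʳ-≡; +-identityˡ; neg-involutive)
  open import Data.Integer.Tactic.RingSolver using (solve; solve-∀)
  open import Algebra.Properties.AbelianGroup Data.Integer.Properties.+-0-abelianGroup using (∙-cancelˡ)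
  open import Data.List using (List; []; _∷_; _++_; length; map; filter; downFrom; concatMap; cartesianProduct; cartesianProductWith)
  open import Data.List.Properties using (length-map; map-∘; map-id-local; map-++; concatMap-cong)
  open import Data.List.Membership.Propositional using (_∈_)
  open import Data.List.Membership.Propositional.Properties
    using (∈-filter⁺; ∈-filter⁻; ∈-map∘filter⁺; ∈-map∘filter⁻; ∈-map⁺; ∈-map⁻; ∈-++⁺ˡ; ∈-++⁺ʳ; ∈-downFrom⁺; ∈-cartesianProduct⁺)
  open import Data.List.Membership.Propositional.Properties.WithK using (unique∧set⇒bag)
  open import Data.List.Relation.Binary.BagAndSetEquality using (_∼[_]_; set; ∼bag⇒↭)
  open import Data.List.Relation.Binary.Permutation.Propositional.Properties using (↭-length)
  open import Data.List.Relation.Unary.Any using (here; there)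
  import Data.List.Relation.Unary.All as All
  import Data.List.Relation.Unary.All.Properties as All
  open import Data.List.Relation.Unary.Unique.Propositional using (Unique; _∷_)
  import Data.List.Relation.Unary.Unique.Propositional.Properties as Unique
  open import Data.Nat as ℕ using (ℕ; zero; suc; _≤_; _<_; z≤n; s≤s; _∸_; NonZero)
  open import Data.Nat.Divisibility using (_∣_; >⇒∤)
  import Data.Nat.Properties as ℕ
  import Data.Nat.Tactic.RingSolver as ℕ-Solver
  open import Data.Product using (_×_; _,_; ∃; proj₁; proj₂; map₂)
  open import Data.Sum as Sum using (_⊎_; inj₁; inj₂)
  open import Function using (_∘_; mk⇔)
  open import Level using (0ℓ)
  open import Relation.Binary.PropositionalEquality using (_≡_; refl; sym; trans; cong; cong₂; subst; module ≡-Reasoning)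
  open import Relation.Nullary using (¬_; Dec; yes; no; ¬?; _×-dec_; _→-dec_; contradiction)
  import Relation.Nullary.Decidable as Dec
  open import Relation.Unary using (Pred; Decidable; _⊆_; _∩_; ∁)
  open import Relation.Unary.Properties using (_∩?_; ∁?)

  private
    variable
      A B C D : Set

  -- Counting along bijections

  count : {P : Pred A 0ℓ} → Decidable P → List A → ℕ
  count P? xs = length (filter P? xs)

  count-split : {P R : Pred A 0ℓ} (P? : Decidable P) (R? : Decidable R) (xs : List A) →
                count P? xs ≡ count (P? ∩? R?) xs ℕ.+ count (P? ∩? ∁? R?) xs
  count-split P? R? [] = refl
  count-split P? R? (x ∷ xs) with P? x | R? x
  ... | yes _ | yes _ = cong suc (count-split P? R? xs)
  ... | yes _ | no  _ = trans (cong suc (count-split P? R? xs)) (sym (ℕ.+-suc _ _))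
  ... | no  _ | _     = count-split P? R? xs

  record InverseOn (P : Pred A 0ℓ) (Q : Pred B 0ℓ) : Set where
    field
      to      : A → B
      from    : B → A
      to-∈    : ∀ {a} → P a → Q (to a)
      from-∈  : ∀ {b} → Q b → P (from b)
      from∘to : ∀ {a} → P a → from (to a) ≡ a
      to∘from : ∀ {b} → Q b → to (from b) ≡ b

  count-cong : {P : Pred A 0ℓ} {Q : Pred B 0ℓ} {P? : Decidable P} {Q? : Decidable Q} {xs : List A} {ys : List B} →
               InverseOn P Q → Unique xs → Unique ys → P ⊆ (_∈ xs) → Q ⊆ (_∈ ys) →
               count P? xs ≡ count Q? ys
  count-cong {P? = P?} {Q? = Q?} {xs} {ys} inv xs! ys! P⊆xs Q⊆ys = begin
    length (filter P? xs)          ≡⟨ sym (length-map to (filter P? xs)) ⟩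
    length (map to (filter P? xs)) ≡⟨ ↭-length (∼bag⇒↭ (unique∧set⇒bag image! (Unique.filter⁺ Q? ys!) same-elements)) ⟩
    length (filter Q? ys)          ∎
    where
    open InverseOn inv
    open ≡-Reasoning
    image! : Unique (map to (filter P? xs))
    image! = Unique.map⁻ (subst Unique (sym from∘to-on-filter) (Unique.filter⁺ P? xs!))
      where
      from∘to-on-filter : map from (map to (filter P? xs)) ≡ filter P? xs
      from∘to-on-filter = trans (sym (map-∘ (filter P? xs))) (map-id-local (All.map from∘to (All.all-filter P? xs)))
    same-elements : map to (filter P? xs) ∼[ set ] filter Q? ys
    same-elements = mk⇔ forward backward
      where
      forward : ∀ {b} → b ∈ map to (filter P? xs) → b ∈ filter Q? ys
      forward b∈ with ∈-map∘filter⁻ to P? {xs = xs} b∈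
      ... | a , _ , refl , Pa = ∈-filter⁺ Q? (Q⊆ys (to-∈ Pa)) (to-∈ Pa)
      backward : ∀ {b} → b ∈ filter Q? ys → b ∈ map to (filter P? xs)
      backward {b} b∈ with ∈-filter⁻ Q? {xs = ys} b∈
      ... | _ , Qb = ∈-map∘filter⁺ to P? (from b , P⊆xs (from-∈ Qb) , sym (to∘from Qb) , from-∈ Qb)

  -- Enumerating the solutions in the search box

  signedRange : List ℕ → List ℤ
  signedRange ks = map -[1+_] ks ++ map +_ (0 ∷ map suc ks)

  -- `range` is built from a local copy of downFrom that cannot be named from here; reading off the
  -- negative prefix recovers it.
  negativePrefix : List ℤ → List ℕ
  negativePrefix (-[1+ k ] ∷ xs) = k ∷ negativePrefix xs
  negativePrefix _               = []

  negativePrefix-++ : ∀ ks xs → negativePrefix (map -[1+_] ks ++ + 0 ∷ xs) ≡ ks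
  negativePrefix-++ []       xs = refl
  negativePrefix-++ (k ∷ ks) xs = cong (k ∷_) (negativePrefix-++ ks xs)

  range≡signedRange : ∀ B → range B ≡ signedRange (downFrom B)
  range≡signedRange zero    = refl
  range≡signedRange (suc B) = cong (λ ks → signedRange (B ∷ ks))
    (trans (sym (negativePrefix-++ _ _))
           (trans (cong negativePrefix (range≡signedRange B)) (negativePrefix-++ (downFrom B) _)))

  signedRange-unique : ∀ {ks} → Unique ks → Unique (signedRange ks)
  signedRange-unique {ks} ks! =
    Unique.++⁺ (Unique.map⁺ -[1+]-injective ks!)
               (All.map⁺ (All.map⁺ (All.universal (λ _ ()) ks)) ∷ Unique.map⁺ +-injective (Unique.map⁺ ℕ.suc-injective ks!))
               negative-nonnegative
    where
    -[1+]-injective : ∀ {a b} → -[1+ a ] ≡ -[1+ b ] → a ≡ b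
    -[1+]-injective refl = refl
    negative-nonnegative : ∀ {x} → ¬ (x ∈ map -[1+_] ks × x ∈ map +_ (0 ∷ map suc ks))
    negative-nonnegative (x∈ , x∈′) with ∈-map⁻ -[1+_] x∈ | ∈-map⁻ +_ x∈′
    ... | _ , _ , refl | _ , _ , ()

  ∈-signedRange : ∀ {B} x → ∣ x ∣ ≤ B → x ∈ signedRange (downFrom B)
  ∈-signedRange (+ zero)  _   = ∈-++⁺ʳ (map -[1+_] _) (here refl)
  ∈-signedRange (+ suc k) k<B = ∈-++⁺ʳ (map -[1+_] _) (there (∈-map⁺ +_ (∈-map⁺ suc (∈-downFrom⁺ k<B))))
  ∈-signedRange -[1+ k ]  k<B = ∈-++⁺ˡ (∈-map⁺ -[1+_] (∈-downFrom⁺ k<B))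

  range-unique : ∀ B → Unique (range B)
  range-unique B = subst Unique (sym (range≡signedRange B)) (signedRange-unique (Unique.downFrom⁺ B))

  ∈-range : ∀ {B} x → ∣ x ∣ ≤ B → x ∈ range B
  ∈-range {B} x ∣x∣≤B = subst (x ∈_) (sym (range≡signedRange B)) (∈-signedRange x ∣x∣≤B)

  concatMap-map≡cartesianProductWith : ∀ (f : A → B → C) xs ys →
    concatMap (λ x → map (f x) ys) xs ≡ cartesianProductWith f xs ys
  concatMap-map≡cartesianProductWith f []       ys = refl
  concatMap-map≡cartesianProductWith f (x ∷ xs) ys = cong (map (f x) ys ++_) (concatMap-map≡cartesianProductWith f xs ys)

  map-cartesianProductWith : ∀ (g : C → D) (f : A → B → C) xs ys →
    map g (cartesianProductWith f xs ys) ≡ cartesianProductWith (λ x y → g (f x y)) xs ys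
  map-cartesianProductWith g f []       ys = refl
  map-cartesianProductWith g f (x ∷ xs) ys =
    trans (map-++ g (map (f x) ys) _) (cong₂ _++_ (sym (map-∘ ys)) (map-cartesianProductWith g f xs ys))

  box3≡cartesianProduct : ∀ B → box3 B ≡ cartesianProduct (range B) (cartesianProduct (range B) (range B))
  box3≡cartesianProduct B = trans (concatMap-cong slice (range B)) (concatMap-map≡cartesianProductWith _,_ (range B) _)
    where
    slice : ∀ x → concatMap (λ y → map (λ z → x , y , z) (range B)) (range B) ≡ map (x ,_) (cartesianProduct (range B) (range B))
    slice x = trans (concatMap-map≡cartesianProductWith (λ y z → x , y , z) (range B) (range B))
                    (sym (map-cartesianProductWith (x ,_) _,_ (range B) (range B)))

  box3-unique : ∀ B → Unique (box3 B)
  box3-unique B = subst Unique (sym (box3≡cartesianProduct B))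
    (Unique.cartesianProduct⁺ (range-unique B) (Unique.cartesianProduct⁺ (range-unique B) (range-unique B)))

  ∈-box3 : ∀ {B} x y z → ∣ x ∣ ≤ B → ∣ y ∣ ≤ B → ∣ z ∣ ≤ B → (x , y , z) ∈ box3 B
  ∈-box3 {B} x y z ∣x∣≤B ∣y∣≤B ∣z∣≤B = subst ((x , y , z) ∈_) (sym (box3≡cartesianProduct B))
    (∈-cartesianProduct⁺ (∈-range x ∣x∣≤B) (∈-cartesianProduct⁺ (∈-range y ∣y∣≤B) (∈-range z ∣z∣≤B)))

  n≤n*n : ∀ n → n ≤ n ℕ.* n
  n≤n*n zero    = z≤n
  n≤n*n (suc n) = ℕ.m≤m*n (suc n) (suc n)

  square≡ : ∀ x → x * x ≡ + (∣ x ∣ ℕ.* ∣ x ∣)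
  square≡ (+ k)    = sym (pos-* k k)
  square≡ -[1+ k ] = refl

  pronic : ℤ → ℕ
  pronic (+ k)    = k ℕ.* (k ∸ 1)
  pronic -[1+ k ] = suc (suc k) ℕ.* suc k

  pronic≡ : ∀ x → x * (x - + 1) ≡ + pronic x
  pronic≡ (+ zero)  = refl
  pronic≡ (+ suc k) = sym (pos-* (suc k) k)
  pronic≡ -[1+ k ]  = cong +_ (trans (cong (λ j → suc k ℕ.* suc (suc j)) (ℕ.+-identityʳ k)) (ℕ.*-comm (suc k) (suc (suc k))))

  double≤pronic : ∀ k → 2 ℕ.* k ≤ suc k ℕ.* k
  double≤pronic k = ℕ.+-monoʳ-≤ k (subst (_≤ k ℕ.* k) (sym (ℕ.+-identityʳ k)) (n≤n*n k))

  pronic-bound : ∀ x n → pronic x ≤ 2 ℕ.* n → ∣ x ∣ ≤ suc n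
  pronic-bound (+ zero)  n _ = z≤n
  pronic-bound (+ suc k) n h = s≤s (ℕ.*-cancelˡ-≤ 2 (ℕ.≤-trans (double≤pronic k) h))
  pronic-bound -[1+ k ]  n h = ℕ.m≤n⇒m≤1+n (ℕ.*-cancelˡ-≤ 2 (ℕ.≤-trans (double≤pronic (suc k)) h))

  pos-weighted-sum : ∀ a b c u v w → + a * + u + + b * + v + + c * + w ≡ + (a ℕ.* u ℕ.+ b ℕ.* v ℕ.+ c ℕ.* w)
  pos-weighted-sum a b c u v w = sym (trans (pos-+ (a ℕ.* u ℕ.+ b ℕ.* v) (c ℕ.* w))
    (cong₂ _+_ (trans (pos-+ (a ℕ.* u) (b ℕ.* v)) (cong₂ _+_ (pos-* a u) (pos-* b v))) (pos-* c w)))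

  summand-bounds : ∀ {a b c u v w M} → 1 ≤ a → 1 ≤ b → 1 ≤ c → a ℕ.* u ℕ.+ b ℕ.* v ℕ.+ c ℕ.* w ≡ M →
                   u ≤ M × v ≤ M × w ≤ M
  summand-bounds {suc a} {suc b} {suc c} {u} {v} {w} _ _ _ refl =
    ℕ.≤-trans (ℕ.m≤m+n u (a ℕ.* u)) (ℕ.≤-trans (ℕ.m≤m+n _ (suc b ℕ.* v)) (ℕ.m≤m+n _ (suc c ℕ.* w))) ,
    ℕ.≤-trans (ℕ.m≤m+n v (b ℕ.* v)) (ℕ.≤-trans (ℕ.m≤n+m _ (suc a ℕ.* u)) (ℕ.m≤m+n _ (suc c ℕ.* w))) ,
    ℕ.≤-trans (ℕ.m≤m+n w (c ℕ.* w)) (ℕ.m≤n+m _ (suc a ℕ.* u ℕ.+ suc b ℕ.* v))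

  Q-bounds : ∀ {a b c M} x y z → 1 ≤ a → 1 ≤ b → 1 ≤ c → Q a b c (x , y , z) ≡ + M →
             ∣ x ∣ ≤ M × ∣ y ∣ ≤ M × ∣ z ∣ ≤ M
  Q-bounds {a} {b} {c} x y z 1≤a 1≤b 1≤c eq
    with summand-bounds 1≤a 1≤b 1≤c (+-injective (trans (sym (pos-weighted-sum a b c _ _ _)) (trans (sym Q≡) eq)))
    where
    Q≡ : Q a b c (x , y , z) ≡ + a * + (∣ x ∣ ℕ.* ∣ x ∣) + + b * + (∣ y ∣ ℕ.* ∣ y ∣) + + c * + (∣ z ∣ ℕ.* ∣ z ∣)
    Q≡ = cong₂ _+_ (cong₂ _+_ (cong (+ a *_) (square≡ x)) (cong (+ b *_) (square≡ y))) (cong (+ c *_) (square≡ z))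
  ... | x≤ , y≤ , z≤ = ℕ.≤-trans (n≤n*n ∣ x ∣) x≤ , ℕ.≤-trans (n≤n*n ∣ y ∣) y≤ , ℕ.≤-trans (n≤n*n ∣ z ∣) z≤

  T2-bounds : ∀ {a b c} n x y z → 1 ≤ a → 1 ≤ b → 1 ≤ c → T2 a b c (x , y , z) ≡ + (2 ℕ.* n) →
              ∣ x ∣ ≤ suc n × ∣ y ∣ ≤ suc n × ∣ z ∣ ≤ suc n
  T2-bounds {a} {b} {c} n x y z 1≤a 1≤b 1≤c eq
    with summand-bounds 1≤a 1≤b 1≤c (+-injective (trans (sym (pos-weighted-sum a b c _ _ _)) (trans (sym T2≡) eq)))
    where
    T2≡ : T2 a b c (x , y , z) ≡ + a * + pronic x + + b * + pronic y + + c * + pronic z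
    T2≡ = cong₂ _+_ (cong₂ _+_ (cong (+ a *_) (pronic≡ x)) (cong (+ b *_) (pronic≡ y))) (cong (+ c *_) (pronic≡ z))
  ... | x≤ , y≤ , z≤ = pronic-bound x n x≤ , pronic-bound y n y≤ , pronic-bound z n z≤

  V : Set
  V = ℤ × ℤ × ℤ

  Rep TriRep : ℕ → ℕ → ℕ → ℕ → Pred V 0ℓ
  Rep    a b c m v = Q a b c v ≡ + m
  TriRep a b c n v = T2 a b c v ≡ + (2 ℕ.* n)

  rep? : ∀ a b c m → Decidable (Rep a b c m)
  rep? a b c m v = Q a b c v ≟ + m

  triRep? : ∀ a b c n → Decidable (TriRep a b c n)
  triRep? a b c n v = T2 a b c v ≟ + (2 ℕ.* n)

  rep⊆box3 : ∀ {a b c m} → 1 ≤ a → 1 ≤ b → 1 ≤ c → Rep a b c m ⊆ (_∈ box3 m)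
  rep⊆box3 1≤a 1≤b 1≤c {x , y , z} eq with Q-bounds x y z 1≤a 1≤b 1≤c eq
  ... | x≤ , y≤ , z≤ = ∈-box3 x y z x≤ y≤ z≤

  triRep⊆box3 : ∀ {a b c n} → 1 ≤ a → 1 ≤ b → 1 ≤ c → TriRep a b c n ⊆ (_∈ box3 (suc n))
  triRep⊆box3 {n = n} 1≤a 1≤b 1≤c {x , y , z} eq with T2-bounds n x y z 1≤a 1≤b 1≤c eq
  ... | x≤ , y≤ , z≤ = ∈-box3 x y z x≤ y≤ z≤

  -- Congruences and parity

  representation-difference : ∀ a b q p d → a + q * d ≡ b + p * d → a - b ≡ (p - q) * d
  representation-difference a b q p d eq = begin
    a - b                     ≡⟨ solve (a ∷ b ∷ q ∷ d ∷ []) ⟩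
    (a + q * d) - q * d - b   ≡⟨ cong (λ t → t - q * d - b) eq ⟩
    (b + p * d) - q * d - b   ≡⟨ solve (b ∷ p ∷ q ∷ d ∷ []) ⟩
    (p - q) * d               ∎
    where open ≡-Reasoning

  module _ {d : ℕ} .{{_ : NonZero d}} where

    remainder-unique : ∀ {r s} q p → r < d → s < d → + r + q * + d ≡ + s + p * + d → r ≡ s
    remainder-unique {r} {s} q p r<d s<d eq with ∣ r ⊖ s ∣ in ∣r⊖s∣≡
    ... | zero  = +-injective (i-j≡0⇒i≡j (+ r) (+ s) (trans (m-n≡m⊖n r s) (∣i∣≡0⇒i≡0 ∣r⊖s∣≡)))
    ... | suc δ = contradiction d∣∣r⊖s∣ (>⇒∤ ∣r⊖s∣<d)
      where
      d∣∣r⊖s∣ : d ∣ suc δ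
      d∣∣r⊖s∣ rewrite sym ∣r⊖s∣≡ =
        ∣⇒∣ᵤ (divides (p - q) (trans (sym (m-n≡m⊖n r s)) (representation-difference (+ r) (+ s) q p (+ d) eq)))
      ∣r⊖s∣<d : suc δ < d
      ∣r⊖s∣<d rewrite sym ∣r⊖s∣≡ = ℕ.≤-<-trans (∣m⊝n∣≤m⊔n r s) (ℕ.⊔-lub r<d s<d)

    [r+qd]%ℕd≡r : ∀ {r} q → r < d → (+ r + q * + d) %ℕ d ≡ r
    [r+qd]%ℕd≡r {r} q r<d = remainder-unique (a /ℕ d) q (n%ℕd<d a d) r<d (sym (a≡a%ℕn+[a/ℕn]*n a d))
      where a = + r + q * + d

    [r+qd]/ℕd≡q : ∀ {r} q → r < d → (+ r + q * + d) /ℕ d ≡ q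
    [r+qd]/ℕd≡q {r} q r<d = *-cancelʳ-≡ (a /ℕ d) q (+ d) (∙-cancelˡ (+ r) (a /ℕ d * + d) (q * + d)
      (trans (cong (λ s → + s + a /ℕ d * + d) (sym ([r+qd]%ℕd≡r q r<d))) (sym (a≡a%ℕn+[a/ℕn]*n a d))))
      where a = + r + q * + d

  infix 4 _≡_mod_
  -- A record rather than a synonym for the equation of residues, so that a and b can be inferred.
  record _≡_mod_ (a b : ℤ) (d : ℕ) .{{_ : NonZero d}} : Set where
    constructor same-residue
    field residue-eq : a %ℕ d ≡ b %ℕ d

  open _≡_mod_ public

  module _ {d : ℕ} .{{_ : NonZero d}} where

    shift-≡mod : ∀ b k → b + k * + d ≡ b mod d
    shift-≡mod b k = same-residue (begin
      (b + k * + d) %ℕ d                          ≡⟨ cong (λ t → (t + k * + d) %ℕ d) (a≡a%ℕn+[a/ℕn]*n b d) ⟩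
      (+ (b %ℕ d) + b /ℕ d * + d + k * + d) %ℕ d  ≡⟨ cong (_%ℕ d) (regroup (+ (b %ℕ d)) (b /ℕ d) k (+ d)) ⟩
      (+ (b %ℕ d) + (b /ℕ d + k) * + d) %ℕ d      ≡⟨ [r+qd]%ℕd≡r (b /ℕ d + k) (n%ℕd<d b d) ⟩
      b %ℕ d                                      ∎)
      where
      open ≡-Reasoning
      regroup : ∀ r q k d → r + q * d + k * d ≡ r + (q + k) * d
      regroup = solve-∀

    ≡mod-intro : ∀ {a b} k → a ≡ b + k * + d → a ≡ b mod d
    ≡mod-intro {b = b} k refl = shift-≡mod b k

    ≡mod-elim : ∀ {a b} → a ≡ b mod d → ∃ λ k → a ≡ b + k * + d
    ≡mod-elim {a} {b} (same-residue a≡b) = a /ℕ d - b /ℕ d , (begin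
      a                                                     ≡⟨ a≡a%ℕn+[a/ℕn]*n a d ⟩
      + (a %ℕ d) + a /ℕ d * + d                             ≡⟨ cong (λ r → + r + a /ℕ d * + d) a≡b ⟩
      + (b %ℕ d) + a /ℕ d * + d                             ≡⟨ regroup (+ (b %ℕ d)) (a /ℕ d) (b /ℕ d) (+ d) ⟩
      + (b %ℕ d) + b /ℕ d * + d + (a /ℕ d - b /ℕ d) * + d  ≡⟨ cong (_+ (a /ℕ d - b /ℕ d) * + d) (sym (a≡a%ℕn+[a/ℕn]*n b d)) ⟩
      b + (a /ℕ d - b /ℕ d) * + d                           ∎)
      where
      open ≡-Reasoning
      regroup : ∀ r p q d → r + p * d ≡ r + q * d + (p - q) * d
      regroup = solve-∀

    ≡mod-sym : ∀ {a b} → a ≡ b mod d → b ≡ a mod d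
    ≡mod-sym (same-residue eq) = same-residue (sym eq)

    ≡mod-trans : ∀ {a b c} → a ≡ b mod d → b ≡ c mod d → a ≡ c mod d
    ≡mod-trans (same-residue eq) (same-residue eq′) = same-residue (trans eq eq′)

    ≡mod? : ∀ a b → Dec (a ≡ b mod d)
    ≡mod? a b = Dec.map′ same-residue residue-eq (a %ℕ d ℕ.≟ b %ℕ d)

    ≡mod-+ʳ : ∀ {a b} c → a ≡ b mod d → a + c ≡ b + c mod d
    ≡mod-+ʳ {b = b} c a≡b with ≡mod-elim a≡b
    ... | k , refl = ≡mod-intro k (regroup b c k (+ d))
      where
      regroup : ∀ b c k d → b + k * d + c ≡ b + c + k * d
      regroup = solve-∀

    /ℕ-exact : ∀ {b} → b ≡ 0ℤ mod d → b /ℕ d * + d ≡ b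
    /ℕ-exact b≡0 with ≡mod-elim b≡0
    ... | k , refl = trans (cong (_* + d) ([r+qd]/ℕd≡q k (ℕ.>-nonZero⁻¹ d))) (sym (+-identityˡ (k * + d)))

  ≡mod4⇒≡mod2 : ∀ {a b} → a ≡ b mod 4 → a ≡ b mod 2
  ≡mod4⇒≡mod2 {b = b} a≡b with ≡mod-elim a≡b
  ... | k , refl = ≡mod-intro (k * + 2) (regroup b k)
    where
    regroup : ∀ b k → b + k * + 4 ≡ b + k * + 2 * + 2
    regroup = solve-∀

  predMultiple succQuotient : (d : ℕ) .{{_ : NonZero d}} → ℤ → ℤ
  predMultiple d k = k * + d - 1ℤ
  succQuotient d a = (a + 1ℤ) /ℕ d

  module _ {d : ℕ} .{{_ : NonZero d}} where

    succQuotient-predMultiple : ∀ k → succQuotient d (predMultiple d k) ≡ k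
    succQuotient-predMultiple k = trans (cong (_/ℕ d) (regroup k (+ d))) ([r+qd]/ℕd≡q k (ℕ.>-nonZero⁻¹ d))
      where
      regroup : ∀ k d → k * d - 1ℤ + 1ℤ ≡ 0ℤ + k * d
      regroup = solve-∀

    predMultiple-succQuotient : ∀ {a} → a + 1ℤ ≡ 0ℤ mod d → predMultiple d (succQuotient d a) ≡ a
    predMultiple-succQuotient {a} a+1≡0 = trans (cong (_- 1ℤ) (/ℕ-exact a+1≡0)) (cancel a)
      where
      cancel : ∀ a → a + 1ℤ - 1ℤ ≡ a
      cancel = solve-∀

  affine-cancel : ∀ d .{{_ : NonZero d}} c s t → c + s * + d ≡ c + t * + d → s ≡ t
  affine-cancel d c s t eq = *-cancelʳ-≡ s t (+ d) (∙-cancelˡ c (s * + d) (t * + d) eq)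

  Even Odd : ℤ → Set
  Even a = a ≡ 0ℤ mod 2
  Odd  a = a ≡ 1ℤ mod 2

  even? : Decidable Even
  even? a = ≡mod? a 0ℤ

  odd? : Decidable Odd
  odd? a = ≡mod? a 1ℤ

  even-or-odd : ∀ a → Even a ⊎ Odd a
  even-or-odd a with a %ℕ 2 in eq | n%ℕd<d a 2
  ... | 0           | _ = inj₁ (same-residue eq)
  ... | 1           | _ = inj₂ (same-residue eq)
  ... | suc (suc _) | s≤s (s≤s ())

  even⇒¬odd : ∀ {a} → Even a → ¬ Odd a
  even⇒¬odd (same-residue e) (same-residue o) with () ← trans (sym e) o

  ¬even⇒odd : ∀ {a} → ¬ Even a → Odd a
  ¬even⇒odd {a} ¬e = Sum.[ (λ e → contradiction e ¬e) , (λ o → o) ]′ (even-or-odd a)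

  odd⇒succ-even : ∀ {a} → Odd a → a + 1ℤ ≡ 0ℤ mod 2
  odd⇒succ-even oa = ≡mod-trans (≡mod-+ʳ 1ℤ oa) (same-residue refl)

  odd-neg : ∀ {a} → Odd a → Odd (- a)
  odd-neg oa with ≡mod-elim oa
  ... | k , refl = ≡mod-intro (- k - 1ℤ) (regroup k)
    where
    regroup : ∀ k → - (1ℤ + k * + 2) ≡ 1ℤ + (- k - 1ℤ) * + 2
    regroup = solve-∀

  module _ (i j : ℤ) where

    odd-congruent-mod-4 : Even (i - j) → 1ℤ + i * + 2 ≡ 1ℤ + j * + 2 mod 4
    odd-congruent-mod-4 i-j-even with ≡mod-elim i-j-even
    ... | t , e = ≡mod-intro t (begin
      1ℤ + i * + 2                         ≡⟨ solve (i ∷ j ∷ []) ⟩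
      1ℤ + j * + 2 + (i - j) * + 2         ≡⟨ cong (λ h → 1ℤ + j * + 2 + h * + 2) e ⟩
      1ℤ + j * + 2 + (0ℤ + t * + 2) * + 2  ≡⟨ solve (j ∷ t ∷ []) ⟩
      1ℤ + j * + 2 + t * + 4               ∎)
      where open ≡-Reasoning

    odd-anticongruent-mod-4 : Odd (i - j) → 1ℤ + i * + 2 ≡ - (1ℤ + j * + 2) mod 4
    odd-anticongruent-mod-4 i-j-odd with ≡mod-elim i-j-odd
    ... | t , e = ≡mod-intro (1ℤ + t + j) (begin
      1ℤ + i * + 2                                           ≡⟨ solve (i ∷ j ∷ []) ⟩
      - (1ℤ + j * + 2) + (i - j + 1ℤ + j * + 2) * + 2         ≡⟨ cong (λ h → - (1ℤ + j * + 2) + (h + 1ℤ + j * + 2) * + 2) e ⟩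
      - (1ℤ + j * + 2) + (1ℤ + t * + 2 + 1ℤ + j * + 2) * + 2  ≡⟨ solve (j ∷ t ∷ []) ⟩
      - (1ℤ + j * + 2) + (1ℤ + t + j) * + 4                  ∎)
      where open ≡-Reasoning

  odd⇒≡mod4⊎≡-mod4 : ∀ {a b} → Odd a → Odd b → a ≡ b mod 4 ⊎ a ≡ - b mod 4
  odd⇒≡mod4⊎≡-mod4 oa ob with ≡mod-elim oa | ≡mod-elim ob
  ... | i , refl | j , refl = Sum.map (odd-congruent-mod-4 i j) (odd-anticongruent-mod-4 i j) (even-or-odd (i - j))

  ≡mod4∧≡-mod4⇒even : ∀ {a b} → a ≡ b mod 4 → a ≡ - b mod 4 → Even b
  ≡mod4∧≡-mod4⇒even {b = b} a≡b a≡-b with ≡mod-elim (≡mod-trans (≡mod-sym a≡b) a≡-b)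
  ... | k , e = ≡mod-intro k (*-cancelʳ-≡ b (0ℤ + k * + 2) (+ 2) (begin
    b * + 2               ≡⟨ solve (b ∷ []) ⟩
    b + b                 ≡⟨ cong (λ h → b + h) e ⟩
    b + (- b + k * + 4)   ≡⟨ solve (b ∷ k ∷ []) ⟩
    (0ℤ + k * + 2) * + 2  ∎))
    where open ≡-Reasoning

  odd-incongruent⇒≡-mod4 : ∀ {a b} → Odd a → Odd b → ¬ a ≡ b mod 4 → a ≡ - b mod 4
  odd-incongruent⇒≡-mod4 oa ob a≢b with odd⇒≡mod4⊎≡-mod4 oa ob
  ... | inj₁ a≡b  = contradiction a≡b a≢b
  ... | inj₂ a≡-b = a≡-b

  odd-congruent⇒≢-mod4 : ∀ {a b} → Odd b → a ≡ b mod 4 → ¬ a ≡ - b mod 4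
  odd-congruent⇒≢-mod4 ob a≡b a≡-b = even⇒¬odd (≡mod4∧≡-mod4⇒even a≡b a≡-b) ob

  shift≡mod4⇒even : ∀ b k → b + k * + 2 ≡ b mod 4 → Even k
  shift≡mod4⇒even b k h with ≡mod-elim h
  ... | j , eq = ≡mod-intro j (*-cancelʳ-≡ k (0ℤ + j * + 2) (+ 2) (trans (∙-cancelˡ b _ _ eq) (regroup j)))
    where
    regroup : ∀ j → j * + 4 ≡ (0ℤ + j * + 2) * + 2
    regroup = solve-∀

  even⇒shift≡mod4 : ∀ b k → Even k → b + k * + 2 ≡ b mod 4
  even⇒shift≡mod4 b k ek with ≡mod-elim ek
  ... | j , refl = ≡mod-intro j (regroup b j)
    where
    regroup : ∀ b j → b + (0ℤ + j * + 2) * + 2 ≡ b + j * + 4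
    regroup = solve-∀

  -- The involution ρ

  EvenIncongruent OddCongruent : ℤ × ℤ → Set
  EvenIncongruent (a , b) = Even a × Even b × ¬ a ≡ b mod 4
  OddCongruent    (a , b) = Odd a × Odd b × a ≡ b mod 4

  module _ (b k : ℤ) where

    evenIncongruent⇒ : EvenIncongruent (b + k * + 2 , b) → Even b × Odd k
    evenIncongruent⇒ (_ , eb , ≢₄) = eb , ¬even⇒odd (≢₄ ∘ even⇒shift≡mod4 b k)

    evenIncongruent⇐ : Even b → Odd k → EvenIncongruent (b + k * + 2 , b)
    evenIncongruent⇐ eb ok = ≡mod-trans (shift-≡mod b k) eb , eb , λ ≡₄ → even⇒¬odd (shift≡mod4⇒even b k ≡₄) ok

    oddCongruent⇒ : OddCongruent (b + k * + 2 , b) → Odd b × Even k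
    oddCongruent⇒ (_ , ob , ≡₄) = ob , shift≡mod4⇒even b k ≡₄

    oddCongruent⇐ : Odd b → Even k → OddCongruent (b + k * + 2 , b)
    oddCongruent⇐ ob ek = ≡mod-trans (shift-≡mod b k) ob , ob , even⇒shift≡mod4 b k ek

  -- On pairs of equal parity this is ((a + 3b)/2, (a − b)/2).
  ρ : ℤ × ℤ → ℤ × ℤ
  ρ (a , b) = k + b * + 2 , k
    where k = (a - b) /ℕ 2

  ρ-shift : ∀ b k → ρ (b + k * + 2 , b) ≡ (k + b * + 2 , k)
  ρ-shift b k = cong (λ h → h + b * + 2 , h) (trans (cong (_/ℕ 2) (regroup b k)) ([r+qd]/ℕd≡q k (s≤s z≤n)))
    where
    regroup : ∀ b k → b + k * + 2 - b ≡ + 0 + k * + 2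
    regroup = solve-∀

  ρ-involutive : ∀ {a b} → a ≡ b mod 2 → ρ (ρ (a , b)) ≡ (a , b)
  ρ-involutive {b = b} a≡b with ≡mod-elim a≡b
  ... | k , refl = trans (cong ρ (ρ-shift b k)) (ρ-shift k b)

  a²+3b² : ℤ × ℤ → ℤ
  a²+3b² (a , b) = a * a + + 3 * (b * b)

  ρ-preserves-a²+3b² : ∀ {a b} → a ≡ b mod 2 → a²+3b² (ρ (a , b)) ≡ a²+3b² (a , b)
  ρ-preserves-a²+3b² {b = b} a≡b with ≡mod-elim a≡b
  ... | k , refl = trans (cong a²+3b² (ρ-shift b k)) (symmetric b k)
    where
    symmetric : ∀ b k → (k + b * + 2) * (k + b * + 2) + + 3 * (k * k) ≡ (b + k * + 2) * (b + k * + 2) + + 3 * (b * b)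
    symmetric = solve-∀

  evenIncongruent⇒≡mod2 : ∀ {a b} → EvenIncongruent (a , b) → a ≡ b mod 2
  evenIncongruent⇒≡mod2 (ea , eb , _) = ≡mod-trans ea (≡mod-sym eb)

  oddCongruent⇒≡mod2 : ∀ {a b} → OddCongruent (a , b) → a ≡ b mod 2
  oddCongruent⇒≡mod2 (oa , ob , _) = ≡mod-trans oa (≡mod-sym ob)

  ρ-evenIncongruent : ∀ {p} → EvenIncongruent p → OddCongruent (ρ p)
  ρ-evenIncongruent {a , b} ei with ≡mod-elim (evenIncongruent⇒≡mod2 ei)
  ... | k , refl with evenIncongruent⇒ b k ei
  ... | eb , ok = subst OddCongruent (sym (ρ-shift b k)) (oddCongruent⇐ k b ok eb)

  ρ-oddCongruent : ∀ {p} → OddCongruent p → EvenIncongruent (ρ p)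
  ρ-oddCongruent {a , b} oc with ≡mod-elim (oddCongruent⇒≡mod2 oc)
  ... | k , refl with oddCongruent⇒ b k oc
  ... | ob , ek = subst EvenIncongruent (sym (ρ-shift b k)) (evenIncongruent⇐ k b ek ob)

  -- Solutions of x² + 3y² + 9z² ≡ 5 (mod 8) that are not all odd

  AllOdd : Pred V 0ℓ
  AllOdd (x , y , z) = Odd x × Odd y × Odd z

  allOdd? : Decidable AllOdd
  allOdd? (x , y , z) = odd? x ×-dec odd? y ×-dec odd? z

  evenIncongruent? : Decidable EvenIncongruent
  evenIncongruent? (a , b) = even? a ×-dec even? b ×-dec ¬? (≡mod? a b)

  NotAllOddShape : Pred V 0ℓ
  NotAllOddShape v@(x , y , z) =
    Q 1 3 9 v ≡ + 5 mod 8 → ¬ AllOdd v →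
    (Even z → Odd x × EvenIncongruent (y , z)) × (¬ Even z → EvenIncongruent (x , y))

  notAllOddShape? : Decidable NotAllOddShape
  notAllOddShape? v@(x , y , z) =
    ≡mod? (Q 1 3 9 v) (+ 5) →-dec ¬? (allOdd? v) →-dec
    ((even? z →-dec (odd? x ×-dec evenIncongruent? (y , z))) ×-dec (¬? (even? z) →-dec evenIncongruent? (x , y)))

  notAllOddShape-residues : ∀ {r} → r < 4 → ∀ {s} → s < 4 → ∀ {t} → t < 4 → NotAllOddShape (+ r , + s , + t)
  notAllOddShape-residues =
    Dec.toWitness {a? = ℕ.allUpTo? (λ r → ℕ.allUpTo? (λ s → ℕ.allUpTo? (λ t → notAllOddShape? (+ r , + s , + t)) 4) 4) 4} _

  -- (x + 4a)² = x² + 8(ax + 2a²)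
  Q-shift-mod-8 : ∀ x y z a b c → Q 1 3 9 (x + a * + 4 , y + b * + 4 , z + c * + 4) ≡ Q 1 3 9 (x , y , z) mod 8
  Q-shift-mod-8 x y z a b c =
    ≡mod-intro (a * x + + 2 * a * a + + 3 * (b * y + + 2 * b * b) + + 9 * (c * z + + 2 * c * c)) (expand x y z a b c)
    where
    expand : ∀ x y z a b c →
      + 1 * ((x + a * + 4) * (x + a * + 4)) + + 3 * ((y + b * + 4) * (y + b * + 4)) + + 9 * ((z + c * + 4) * (z + c * + 4)) ≡
      (+ 1 * (x * x) + + 3 * (y * y) + + 9 * (z * z)) + (a * x + + 2 * a * a + + 3 * (b * y + + 2 * b * b) + + 9 * (c * z + + 2 * c * c)) * + 8
    expand = solve-∀

  parity-shift : ∀ a k {c} → a ≡ c mod 2 → a + k * + 4 ≡ c mod 2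
  parity-shift a k = ≡mod-trans (≡mod4⇒≡mod2 (shift-≡mod a k))

  parity-shift⁻ : ∀ a k {c} → a + k * + 4 ≡ c mod 2 → a ≡ c mod 2
  parity-shift⁻ a k = ≡mod-trans (≡mod-sym (≡mod4⇒≡mod2 (shift-≡mod a k)))

  evenIncongruent-shift : ∀ a k b l → EvenIncongruent (a , b) → EvenIncongruent (a + k * + 4 , b + l * + 4)
  evenIncongruent-shift a k b l (ea , eb , a≢b) =
    parity-shift a k ea , parity-shift b l eb ,
    λ a≡b → a≢b (≡mod-trans (≡mod-sym (shift-≡mod a k)) (≡mod-trans a≡b (shift-≡mod b l)))

  notAllOddShape-shift : ∀ {x y z} a b c → NotAllOddShape (x , y , z) → NotAllOddShape (x + a * + 4 , y + b * + 4 , z + c * + 4)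
  notAllOddShape-shift {x} {y} {z} a b c shape Q≡5 ¬allOdd
    with shape (≡mod-trans (≡mod-sym (Q-shift-mod-8 x y z a b c)) Q≡5)
               (λ (ox , oy , oz) → ¬allOdd (parity-shift x a ox , parity-shift y b oy , parity-shift z c oz))
  ... | evenCase , oddCase =
    (λ ez → let ox , ei = evenCase (parity-shift⁻ z c ez) in parity-shift x a ox , evenIncongruent-shift y b z c ei) ,
    (λ ¬ez → evenIncongruent-shift x a y b (oddCase (¬ez ∘ parity-shift z c)))

  -- Q mod 8 only depends on v mod 4, so the 64 residue triples, checked by computation, settle it.
  notAllOddShape : ∀ v → NotAllOddShape v
  notAllOddShape (x , y , z) =
    subst NotAllOddShape (sym (cong₂ _,_ (residue-quotient x) (cong₂ _,_ (residue-quotient y) (residue-quotient z))))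
      (notAllOddShape-shift (x /ℕ 4) (y /ℕ 4) (z /ℕ 4) (notAllOddShape-residues (n%ℕd<d x 4) (n%ℕd<d y 4) (n%ℕd<d z 4)))
    where
    residue-quotient : ∀ a → a ≡ + (a %ℕ 4) + a /ℕ 4 * + 4
    residue-quotient a = a≡a%ℕn+[a/ℕn]*n a 4

  -- From t(1,3,9) to t(1,3,27)

  pronic-shift-mod-3 : ∀ r q → (r + q * + 3) * (r + q * + 3 - + 1) ≡ r * (r - + 1) mod 3
  pronic-shift-mod-3 r q = ≡mod-intro (q * (+ 2 * r + q * + 3 - + 1)) (expand r q)
    where
    expand : ∀ r q → (r + q * + 3) * (r + q * + 3 - + 1) ≡ r * (r - + 1) + q * (+ 2 * r + q * + 3 - + 1) * + 3
    expand = solve-∀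

  pronic-residue≡2 : ∀ {r} → r < 3 → + r * (+ r - + 1) ≡ + 2 mod 3 → r ≡ 2
  pronic-residue≡2 {0} _ (same-residue ())
  pronic-residue≡2 {1} _ (same-residue ())
  pronic-residue≡2 {2} _ _ = refl
  pronic-residue≡2 {suc (suc (suc _))} (s≤s (s≤s (s≤s ()))) _

  pronic≡2⇒≡2-mod-3 : ∀ x → x * (x - + 1) ≡ + 2 mod 3 → x ≡ + 2 mod 3
  pronic≡2⇒≡2-mod-3 x h = same-residue (pronic-residue≡2 (n%ℕd<d x 3) (≡mod-trans (≡mod-sym via-residue) h))
    where
    r = + (x %ℕ 3)
    via-residue : x * (x - + 1) ≡ r * (r - + 1) mod 3
    via-residue = subst (λ t → t * (t - + 1) ≡ r * (r - + 1) mod 3) (sym (a≡a%ℕn+[a/ℕn]*n x 3)) (pronic-shift-mod-3 r (x /ℕ 3))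

  T2-1-3-27≡pronic-mod-3 : ∀ x y z → T2 1 3 27 (x , y , z) ≡ x * (x - + 1) mod 3
  T2-1-3-27≡pronic-mod-3 x y z = ≡mod-intro (y * (y - + 1) + + 9 * (z * (z - + 1))) (expand x y z)
    where
    expand : ∀ x y z → + 1 * (x * (x - + 1)) + + 3 * (y * (y - + 1)) + + 27 * (z * (z - + 1)) ≡
                       x * (x - + 1) + (y * (y - + 1) + + 9 * (z * (z - + 1))) * + 3
    expand = solve-∀

  swap-scale swap-unscale : V → V
  swap-scale   (x , y , z) = predMultiple 3 y , x , z
  swap-unscale (x , y , z) = y , succQuotient 3 x , z

  T2-swap-scale : ∀ v → T2 1 3 27 (swap-scale v) ≡ + 2 + T2 1 3 9 v * + 3
  T2-swap-scale (x , y , z) = expand x y z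
    where
    expand : ∀ x y z → + 1 * ((y * + 3 - 1ℤ) * (y * + 3 - 1ℤ - + 1)) + + 3 * (x * (x - + 1)) + + 27 * (z * (z - + 1)) ≡
                       + 2 + (+ 1 * (x * (x - + 1)) + + 3 * (y * (y - + 1)) + + 9 * (z * (z - + 1))) * + 3
    expand = solve-∀

  module _ (n : ℕ) where

    2[3n+1]≡ : + (2 ℕ.* (3 ℕ.* n ℕ.+ 1)) ≡ + 2 + + (2 ℕ.* n) * + 3
    2[3n+1]≡ = trans (cong +_ (regroup n)) (trans (pos-+ 2 (2 ℕ.* n ℕ.* 3)) (cong (λ t → + 2 + t) (pos-* (2 ℕ.* n) 3)))
      where
      regroup : ∀ n → 2 ℕ.* (3 ℕ.* n ℕ.+ 1) ≡ 2 ℕ.+ 2 ℕ.* n ℕ.* 3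
      regroup = ℕ-Solver.solve-∀

    swap-scale∘swap-unscale : ∀ {v} → TriRep 1 3 27 (3 ℕ.* n ℕ.+ 1) v → swap-scale (swap-unscale v) ≡ v
    swap-scale∘swap-unscale {x , y , z} eq =
      cong (λ t → t , y , z) (predMultiple-succQuotient (≡mod-trans (≡mod-+ʳ 1ℤ x≡2) (same-residue refl)))
      where
      x≡2 : x ≡ + 2 mod 3
      x≡2 = pronic≡2⇒≡2-mod-3 x (≡mod-trans (≡mod-sym (T2-1-3-27≡pronic-mod-3 x y z))
                                  (subst (_≡ + 2 mod 3) (sym eq) (≡mod-intro (+ (2 ℕ.* n)) 2[3n+1]≡)))

    triRep-swap-scale : InverseOn (TriRep 1 3 9 n) (TriRep 1 3 27 (3 ℕ.* n ℕ.+ 1))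
    triRep-swap-scale = record
      { to      = swap-scale
      ; from    = swap-unscale
      ; to-∈    = λ {v} eq → trans (T2-swap-scale v) (trans (cong (λ t → + 2 + t * + 3) eq) (sym 2[3n+1]≡))
      ; from-∈  = λ {v} eq → affine-cancel 3 (+ 2) (T2 1 3 9 (swap-unscale v)) (+ (2 ℕ.* n))
                    (trans (sym (T2-swap-scale (swap-unscale v)))
                           (trans (cong (T2 1 3 27) (swap-scale∘swap-unscale {v} eq)) (trans eq 2[3n+1]≡)))
      ; from∘to = λ { {x , y , z} _ → cong (λ t → x , t , z) (succQuotient-predMultiple y) }
      ; to∘from = swap-scale∘swap-unscale
      }

  t3-1-3-9≡t3-1-3-27 : ∀ n → t3 1 3 9 n ≡ t3 1 3 27 (3 ℕ.* n ℕ.+ 1)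
  t3-1-3-9≡t3-1-3-27 n =
    count-cong {P? = triRep? 1 3 9 n} {Q? = triRep? 1 3 27 (3 ℕ.* n ℕ.+ 1)} (triRep-swap-scale n)
      (box3-unique (suc n)) (box3-unique (suc (3 ℕ.* n ℕ.+ 1)))
      (triRep⊆box3 {1} {3} {9} {n} (s≤s z≤n) (s≤s z≤n) (s≤s z≤n))
      (triRep⊆box3 {1} {3} {27} {3 ℕ.* n ℕ.+ 1} (s≤s z≤n) (s≤s z≤n) (s≤s z≤n))

  -- Counting the solutions of x² + 3y² + 9z² = 8n + 13

  map³ : (ℤ → ℤ) → V → V
  map³ f (x , y , z) = f x , f y , f z

  onXY : (ℤ × ℤ → ℤ × ℤ) → V → V
  onXY f (x , y , z) = proj₁ (f (x , y)) , proj₂ (f (x , y)) , z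

  negateY negateZ : V → V
  negateY (x , y , z) = x , - y , z
  negateZ (x , y , z) = x , y , - z

  EvenZ CongruentYZ CongruentXY : Pred V 0ℓ
  EvenZ       (_ , _ , z) = Even z
  CongruentYZ (_ , y , z) = y ≡ z mod 4
  CongruentXY (x , y , _) = x ≡ y mod 4

  evenZ? : Decidable EvenZ
  evenZ? (_ , _ , z) = even? z

  congruentYZ? : Decidable CongruentYZ
  congruentYZ? (_ , y , z) = ≡mod? y z

  congruentXY? : Decidable CongruentXY
  congruentXY? (x , y , _) = ≡mod? x y

  Q-predMultiple-2 : ∀ v → Q 1 3 9 (map³ (predMultiple 2) v) ≡ + 13 + T2 1 3 9 v * + 4
  Q-predMultiple-2 (x , y , z) = expand x y z
    where
    expand : ∀ x y z →
      + 1 * ((x * + 2 - 1ℤ) * (x * + 2 - 1ℤ)) + + 3 * ((y * + 2 - 1ℤ) * (y * + 2 - 1ℤ)) + + 9 * ((z * + 2 - 1ℤ) * (z * + 2 - 1ℤ)) ≡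
      + 13 + (+ 1 * (x * (x - + 1)) + + 3 * (y * (y - + 1)) + + 9 * (z * (z - + 1))) * + 4
    expand = solve-∀

  odd-predMultiple-2 : ∀ k → Odd (predMultiple 2 k)
  odd-predMultiple-2 k = ≡mod-intro (k - 1ℤ) (regroup k)
    where
    regroup : ∀ k → k * + 2 - 1ℤ ≡ 1ℤ + (k - 1ℤ) * + 2
    regroup = solve-∀

  Q-ρ-yz : ∀ x y z → y ≡ z mod 2 → Q 1 3 9 (x , ρ (y , z)) ≡ Q 1 3 9 (x , y , z)
  Q-ρ-yz x y z y≡z = trans (split x (proj₁ (ρ (y , z))) (proj₂ (ρ (y , z))))
    (trans (cong (λ t → + 1 * (x * x) + + 3 * t) (ρ-preserves-a²+3b² y≡z)) (sym (split x y z)))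
    where
    split : ∀ x y z → + 1 * (x * x) + + 3 * (y * y) + + 9 * (z * z) ≡ + 1 * (x * x) + + 3 * (y * y + + 3 * (z * z))
    split = solve-∀

  Q-ρ-xy : ∀ x y z → x ≡ y mod 2 → Q 1 3 9 (onXY ρ (x , y , z)) ≡ Q 1 3 9 (x , y , z)
  Q-ρ-xy x y z x≡y = trans (split (proj₁ (ρ (x , y))) (proj₂ (ρ (x , y))) z)
    (trans (cong (λ t → t + + 9 * (z * z)) (ρ-preserves-a²+3b² x≡y)) (sym (split x y z)))
    where
    split : ∀ x y z → + 1 * (x * x) + + 3 * (y * y) + + 9 * (z * z) ≡ (x * x + + 3 * (y * y)) + + 9 * (z * z)
    split = solve-∀

  Q-negateY : ∀ v → Q 1 3 9 (negateY v) ≡ Q 1 3 9 v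
  Q-negateY (x , y , z) = expand x y z
    where
    expand : ∀ x y z → + 1 * (x * x) + + 3 * (- y * - y) + + 9 * (z * z) ≡ + 1 * (x * x) + + 3 * (y * y) + + 9 * (z * z)
    expand = solve-∀

  Q-negateZ : ∀ v → Q 1 3 9 (negateZ v) ≡ Q 1 3 9 v
  Q-negateZ (x , y , z) = expand x y z
    where
    expand : ∀ x y z → + 1 * (x * x) + + 3 * (y * y) + + 9 * (- z * - z) ≡ + 1 * (x * x) + + 3 * (y * y) + + 9 * (z * z)
    expand = solve-∀

  sum-of-halves : ∀ {o a b} → o ≡ a ℕ.+ a → o ≡ b ℕ.+ b → a ℕ.+ b ≡ o
  sum-of-halves {o} {a} {b} o≡a+a o≡b+b = ℕ.*-cancelˡ-≡ (a ℕ.+ b) o 2 (begin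
    2 ℕ.* (a ℕ.+ b)        ≡⟨ ℕ-Solver.solve (a ∷ b ∷ []) ⟩
    a ℕ.+ a ℕ.+ (b ℕ.+ b)  ≡⟨ cong₂ ℕ._+_ (sym o≡a+a) (sym o≡b+b) ⟩
    o ℕ.+ o                ≡⟨ ℕ-Solver.solve (o ∷ []) ⟩
    2 ℕ.* o                ∎)
    where open ≡-Reasoning

  module _ (n : ℕ) where

    private
      m : ℕ
      m = 8 ℕ.* n ℕ.+ 13
      Sol = Rep 1 3 9 m
      sol? = rep? 1 3 9 m

    8n+13≡ : + m ≡ + 13 + + (2 ℕ.* n) * + 4
    8n+13≡ = trans (cong +_ (regroup n)) (trans (pos-+ 13 (2 ℕ.* n ℕ.* 4)) (cong (λ t → + 13 + t) (pos-* (2 ℕ.* n) 4)))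
      where
      regroup : ∀ n → 8 ℕ.* n ℕ.+ 13 ≡ 13 ℕ.+ 2 ℕ.* n ℕ.* 4
      regroup = ℕ-Solver.solve-∀

    sol≡5-mod-8 : ∀ v → Sol v → Q 1 3 9 v ≡ + 5 mod 8
    sol≡5-mod-8 v sol =
      ≡mod-intro (+ n + 1ℤ) (trans sol (trans 8n+13≡ (trans (cong (λ t → + 13 + t * + 4) (pos-* 2 n)) (regroup (+ n)))))
      where
      regroup : ∀ n → + 13 + + 2 * n * + 4 ≡ + 5 + (n + 1ℤ) * + 8
      regroup = solve-∀

    triRep↔oddSol : InverseOn (TriRep 1 3 9 n) (Sol ∩ AllOdd)
    triRep↔oddSol = record
      { to      = map³ (predMultiple 2)
      ; from    = map³ (succQuotient 2)
      ; to-∈    = λ { {v@(x , y , z)} eq →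
                      trans (Q-predMultiple-2 v) (trans (cong (λ t → + 13 + t * + 4) eq) (sym 8n+13≡)) ,
                      odd-predMultiple-2 x , odd-predMultiple-2 y , odd-predMultiple-2 z }
      ; from-∈  = λ {v} q → affine-cancel 4 (+ 13) (T2 1 3 9 (map³ (succQuotient 2) v)) (+ (2 ℕ.* n))
                    (trans (sym (Q-predMultiple-2 (map³ (succQuotient 2) v)))
                           (trans (cong (Q 1 3 9) (to∘from {v} q)) (trans (proj₁ q) 8n+13≡)))
      ; from∘to = λ { {x , y , z} _ →
                      cong₂ _,_ (succQuotient-predMultiple x) (cong₂ _,_ (succQuotient-predMultiple y) (succQuotient-predMultiple z)) }
      ; to∘from = to∘from
      }
      where
      to∘from : ∀ {v} → (Sol ∩ AllOdd) v → map³ (predMultiple 2) (map³ (succQuotient 2) v) ≡ v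
      to∘from {x , y , z} (_ , ox , oy , oz) =
        cong₂ _,_ (predMultiple-succQuotient (odd⇒succ-even ox))
          (cong₂ _,_ (predMultiple-succQuotient (odd⇒succ-even oy)) (predMultiple-succQuotient (odd⇒succ-even oz)))

    solutions-ρ-yz : InverseOn ((Sol ∩ ∁ AllOdd) ∩ EvenZ) ((Sol ∩ AllOdd) ∩ CongruentYZ)
    solutions-ρ-yz = record
      { to      = map₂ ρ
      ; from    = map₂ ρ
      ; to-∈    = λ { {x , y , z} p@((sol , _) , _) →
                      let ox , ei = shape p ; oy′ , oz′ , c′ = ρ-evenIncongruent ei in
                      (trans (Q-ρ-yz x y z (evenIncongruent⇒≡mod2 ei)) sol , ox , oy′ , oz′) , c′ }
      ; from-∈  = λ { {x , y , z} ((sol , _ , oy , oz) , c) →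
                      let _ , ez′ , _ = ρ-oddCongruent (oy , oz , c) in
                      (trans (Q-ρ-yz x y z (oddCongruent⇒≡mod2 (oy , oz , c))) sol , (λ (_ , _ , oz′) → even⇒¬odd ez′ oz′)) , ez′ }
      ; from∘to = λ { {x , y , z} p → cong (x ,_) (ρ-involutive (evenIncongruent⇒≡mod2 (proj₂ (shape p)))) }
      ; to∘from = λ { {x , y , z} ((_ , _ , oy , oz) , c) → cong (x ,_) (ρ-involutive (oddCongruent⇒≡mod2 (oy , oz , c))) }
      }
      where
      shape : ∀ {x y z} → ((Sol ∩ ∁ AllOdd) ∩ EvenZ) (x , y , z) → Odd x × EvenIncongruent (y , z)
      shape {x} {y} {z} ((sol , ¬allOdd) , ez) = proj₁ (notAllOddShape (x , y , z) (sol≡5-mod-8 (x , y , z) sol) ¬allOdd) ez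

    solutions-ρ-xy : InverseOn ((Sol ∩ ∁ AllOdd) ∩ ∁ EvenZ) ((Sol ∩ AllOdd) ∩ CongruentXY)
    solutions-ρ-xy = record
      { to      = onXY ρ
      ; from    = onXY ρ
      ; to-∈    = λ { {x , y , z} p@((sol , _) , ¬ez) →
                      let ei = shape p ; ox′ , oy′ , c′ = ρ-evenIncongruent ei in
                      (trans (Q-ρ-xy x y z (evenIncongruent⇒≡mod2 ei)) sol , ox′ , oy′ , ¬even⇒odd ¬ez) , c′ }
      ; from-∈  = λ { {x , y , z} ((sol , ox , oy , oz) , c) →
                      let ex′ , _ = ρ-oddCongruent (ox , oy , c) in
                      (trans (Q-ρ-xy x y z (oddCongruent⇒≡mod2 (ox , oy , c))) sol , (λ (ox′ , _) → even⇒¬odd ex′ ox′)) ,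
                      (λ ez → even⇒¬odd ez oz) }
      ; from∘to = λ { {x , y , z} p → cong (λ q → proj₁ q , proj₂ q , z) (ρ-involutive (evenIncongruent⇒≡mod2 (shape p))) }
      ; to∘from = λ { {x , y , z} ((_ , ox , oy , _) , c) →
                      cong (λ q → proj₁ q , proj₂ q , z) (ρ-involutive (oddCongruent⇒≡mod2 (ox , oy , c))) }
      }
      where
      shape : ∀ {x y z} → ((Sol ∩ ∁ AllOdd) ∩ ∁ EvenZ) (x , y , z) → EvenIncongruent (x , y)
      shape {x} {y} {z} ((sol , ¬allOdd) , ¬ez) = proj₂ (notAllOddShape (x , y , z) (sol≡5-mod-8 (x , y , z) sol) ¬allOdd) ¬ez

    solutions-negateZ : InverseOn ((Sol ∩ AllOdd) ∩ CongruentYZ) ((Sol ∩ AllOdd) ∩ ∁ CongruentYZ)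
    solutions-negateZ = record
      { to      = negateZ
      ; from    = negateZ
      ; to-∈    = λ { {v} ((sol , ox , oy , oz) , c) → (trans (Q-negateZ v) sol , ox , oy , odd-neg oz) , odd-congruent⇒≢-mod4 oz c }
      ; from-∈  = λ { {v} ((sol , ox , oy , oz) , ¬c) → (trans (Q-negateZ v) sol , ox , oy , odd-neg oz) , odd-incongruent⇒≡-mod4 oy oz ¬c }
      ; from∘to = λ { {x , y , z} _ → cong (λ t → x , y , t) (neg-involutive z) }
      ; to∘from = λ { {x , y , z} _ → cong (λ t → x , y , t) (neg-involutive z) }
      }

    solutions-negateY : InverseOn ((Sol ∩ AllOdd) ∩ CongruentXY) ((Sol ∩ AllOdd) ∩ ∁ CongruentXY)
    solutions-negateY = record
      { to      = negateY
      ; from    = negateY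
      ; to-∈    = λ { {v} ((sol , ox , oy , oz) , c) → (trans (Q-negateY v) sol , ox , odd-neg oy , oz) , odd-congruent⇒≢-mod4 oy c }
      ; from-∈  = λ { {v} ((sol , ox , oy , oz) , ¬c) → (trans (Q-negateY v) sol , ox , odd-neg oy , oz) , odd-incongruent⇒≡-mod4 ox oy ¬c }
      ; from∘to = λ { {x , y , z} _ → cong (λ t → x , t , z) (neg-involutive y) }
      ; to∘from = λ { {x , y , z} _ → cong (λ t → x , t , z) (neg-involutive y) }
      }

    count-solutions-cong : {X Y X′ Y′ : Pred V 0ℓ} {P? : Decidable ((Sol ∩ X) ∩ Y)} {R? : Decidable ((Sol ∩ X′) ∩ Y′)} →
                           InverseOn ((Sol ∩ X) ∩ Y) ((Sol ∩ X′) ∩ Y′) → count P? (box3 m) ≡ count R? (box3 m)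
    count-solutions-cong inv =
      count-cong inv (box3-unique m) (box3-unique m) (λ p → sol⊆box3 (proj₁ (proj₁ p))) (λ r → sol⊆box3 (proj₁ (proj₁ r)))
      where
      sol⊆box3 : Sol ⊆ (_∈ box3 m)
      sol⊆box3 = rep⊆box3 {1} {3} {9} {m} (s≤s z≤n) (s≤s z≤n) (s≤s z≤n)

    private
      #allOdd #allOdd-yz #allOdd-xy : ℕ
      #allOdd    = count (sol? ∩? allOdd?) (box3 m)
      #allOdd-yz = count ((sol? ∩? allOdd?) ∩? congruentYZ?) (box3 m)
      #allOdd-xy = count ((sol? ∩? allOdd?) ∩? congruentXY?) (box3 m)

    t3≡#allOdd : t3 1 3 9 n ≡ #allOdd
    t3≡#allOdd = count-cong {P? = triRep? 1 3 9 n} triRep↔oddSol (box3-unique (suc n)) (box3-unique m)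
      (triRep⊆box3 {1} {3} {9} {n} (s≤s z≤n) (s≤s z≤n) (s≤s z≤n))
      (λ q → rep⊆box3 {1} {3} {9} {m} (s≤s z≤n) (s≤s z≤n) (s≤s z≤n) (proj₁ q))

    #allOdd≡2#allOdd-yz : #allOdd ≡ #allOdd-yz ℕ.+ #allOdd-yz
    #allOdd≡2#allOdd-yz = trans (count-split (sol? ∩? allOdd?) congruentYZ? (box3 m))
      (cong (#allOdd-yz ℕ.+_) (sym (count-solutions-cong solutions-negateZ)))

    #allOdd≡2#allOdd-xy : #allOdd ≡ #allOdd-xy ℕ.+ #allOdd-xy
    #allOdd≡2#allOdd-xy = trans (count-split (sol? ∩? allOdd?) congruentXY? (box3 m))
      (cong (#allOdd-xy ℕ.+_) (sym (count-solutions-cong solutions-negateY)))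

    #notAllOdd≡#allOdd-yz+#allOdd-xy : count (sol? ∩? ∁? allOdd?) (box3 m) ≡ #allOdd-yz ℕ.+ #allOdd-xy
    #notAllOdd≡#allOdd-yz+#allOdd-xy = trans (count-split (sol? ∩? ∁? allOdd?) evenZ? (box3 m))
      (cong₂ ℕ._+_ (count-solutions-cong solutions-ρ-yz) (count-solutions-cong solutions-ρ-xy))

    N3≡2*t3 : N3 1 3 9 m ≡ 2 ℕ.* t3 1 3 9 n
    N3≡2*t3 = begin
      N3 1 3 9 m                                        ≡⟨ count-split sol? allOdd? (box3 m) ⟩
      #allOdd ℕ.+ count (sol? ∩? ∁? allOdd?) (box3 m)   ≡⟨ cong (#allOdd ℕ.+_) #notAllOdd≡#allOdd-yz+#allOdd-xy ⟩
      #allOdd ℕ.+ (#allOdd-yz ℕ.+ #allOdd-xy)           ≡⟨ cong (#allOdd ℕ.+_) #allOdd-yz+#allOdd-xy≡#allOdd ⟩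
      #allOdd ℕ.+ #allOdd                               ≡⟨ cong (λ k → k ℕ.+ k) (sym t3≡#allOdd) ⟩
      t3 1 3 9 n ℕ.+ t3 1 3 9 n                         ≡⟨ cong (t3 1 3 9 n ℕ.+_) (sym (ℕ.+-identityʳ _)) ⟩
      2 ℕ.* t3 1 3 9 n                                  ∎
      where
      open ≡-Reasoning
      #allOdd-yz+#allOdd-xy≡#allOdd : #allOdd-yz ℕ.+ #allOdd-xy ≡ #allOdd
      #allOdd-yz+#allOdd-xy≡#allOdd = sum-of-halves {#allOdd} {#allOdd-yz} {#allOdd-xy} #allOdd≡2#allOdd-yz #allOdd≡2#allOdd-xy

open Representations using (t3-1-3-9≡t3-1-3-27; N3≡2*t3)
open import Data.Nat using (ℕ; _+_; _*_)
open import Data.Product using (_×_; _,_)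
open import Relation.Binary.PropositionalEquality using (_≡_; sym)

theorem2p4 : (n : ℕ) → 1 Data.Nat.≤ n →
    (t3 1 3 9 n ≡ t3 1 3 27 (3 * n + 1)) × (2 * t3 1 3 9 n ≡ N3 1 3 9 (8 * n + 13))
theorem2p4 n _ = t3-1-3-9≡t3-1-3-27 n , sym (N3≡2*t3 n)
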